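{- Let $k\ge1$, $n\ge k+2$, $w=n-k-2$, and let $(d_{i,j})$ be the frieze associated with an equation in $\mathcal{E}_{k+1,n}$ with coefficients $a_i^j$. Extend the notation by $a_m^{k+1}:=1$ and $a_m^l:=0$ for $l>k+1$. Then for every $i\in\mathbb{Z}$ and every $0\le j<w$, $d_{i,i+j}$ equals the determinant of the $(j+1)\times(j+1)$ matrix $(m_{rc})_{0\le r,c\le j}$ with $m_{rc}=a_{i+r}^{\,r-c+1}$ for $c\le r$, $m_{r,r+1}=1$, and $m_{rc}=0$ for $c>r+1$. (In particular, for $0\le j\le k-1$, $j<w$, only coefficients $a^l$ with $l\le k$ occur, and for $k-1<j<w$ the matrix has the entries $1=a^{k+1}$ on the $k$-th subdiagonal and zeros below it.)
   Context: $\mathcal{E}_{k+1,n}$ is the set of difference equations $V_i=a_i^1V_{i-1}-a_i^2V_{i-2}+\cdots+(-1)^{k-1}a_i^kV_{i-k}+(-1)^kV_{i-k-1}$ with real $n$-periodic coefficients such that every solution satisfies $V_{i+n}=(-1)^kV_i$. The frieze associated with such an equation is the array $d_{i,j}:=V_j$, where $(V_s)$ is the solution with $V_{i-k-1}=\dots=V_{i-2}=0$, $V_{i-1}=1$. -}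

module Defs where

open import Level using (_⊔_)
open import Algebra.Bundles using (CommutativeRing)
open import Data.Nat as ℕ using (ℕ; zero; suc; _∸_; _≤ᵇ_; _≡ᵇ_)
open import Data.Fin using (Fin; zero; suc; toℕ; punchIn)
open import Data.Integer as ℤ using (ℤ; +_)
open import Data.Bool using (if_then_else_)

-- Everything is developed over an arbitrary commutative ring R
-- (the paper uses R = ℝ).
module WithRing {c ℓ} (R : CommutativeRing c ℓ) where
  open CommutativeRing R public using (Carrier; _≈_)
  open CommutativeRing R using (_+_; _*_; -_; 0#; 1#)

  sign : ℕ → Carrier
  sign zero = 1#
  sign (suc m) = - sign m

  finSum : (m : ℕ) → (Fin m → Carrier) → Carrier
  finSum zero f = 0#
  finSum (suc m) f = f zero + finSum m (λ t → f (suc t))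

  det : (m : ℕ) → (Fin m → Fin m → Carrier) → Carrier
  det zero M = 1#
  det (suc m) M =
    finSum (suc m) (λ col → sign (toℕ col) * (M zero col *
      det m (λ r c' → M (suc r) (punchIn col c'))))

  -- Coefficients: a i l stands for a_i^l (only 1 ≤ l ≤ k is meaningful).
  Coeffs : Set c
  Coeffs = ℤ → ℕ → Carrier

  IsSolution : (k : ℕ) → Coeffs → (ℤ → Carrier) → Set ℓ
  IsSolution k a V = ∀ (i : ℤ) →
    V i ≈ finSum k (λ t → sign (toℕ t) * (a i (suc (toℕ t)) * V (i ℤ.- + suc (toℕ t))))
          + sign k * V (i ℤ.- + suc k)

  InE : (k n : ℕ) → Coeffs → Set (c ⊔ ℓ)
  InE k n a =
    (∀ (i : ℤ) (l : ℕ) → 1 ℕ.≤ l → l ℕ.≤ k → a (i ℤ.+ + n) l ≈ a i l)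
    × (∀ (V : ℤ → Carrier) → IsSolution k a V → ∀ (i : ℤ) → V (i ℤ.+ + n) ≈ sign k * V i)
    where open import Data.Product using (_×_)

  -- V is the solution used to define row i of the frieze:
  -- V_{i-k-1} = ... = V_{i-2} = 0, V_{i-1} = 1  (so d_{i,j} = V_j).
  IsFriezeRow : (k : ℕ) → Coeffs → ℤ → (ℤ → Carrier) → Set ℓ
  IsFriezeRow k a i V =
    IsSolution k a V
    × (∀ (l : ℕ) → 2 ℕ.≤ l → l ℕ.≤ suc k → V (i ℤ.- + l) ≈ 0#)
    × V (i ℤ.- + 1) ≈ 1#
    where open import Data.Product using (_×_)

  ext : (k : ℕ) → Coeffs → ℤ → ℕ → Carrier
  ext k a m l = if l ≤ᵇ k then a m l else (if l ≡ᵇ suc k then 1# else 0#)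

  friezeMatrix : (k : ℕ) → Coeffs → ℤ → (j : ℕ) → Fin (suc j) → Fin (suc j) → Carrier
  friezeMatrix k a i j r c' =
    if toℕ c' ≤ᵇ toℕ r
      then ext k a (i ℤ.+ + toℕ r) (suc (toℕ r ∸ toℕ c'))
      else (if toℕ c' ≡ᵇ suc (toℕ r) then 1# else 0#)

-- Expanding the determinant D_{j+1} of the (j+1)×(j+1) lower Hessenberg matrix (m_rc) with unit
-- superdiagonal along its last row gives D_{j+1} = Σ_{c+d=j} (-1)^d m_{jc} D_c, with D_0 = 1; this
-- recurrence follows by induction from the first-row expansion, which has only two nonzero terms.
-- For the frieze matrix, m_{j,j-d} = a_{i+j}^{d+1}, so the recurrence is the difference equation
-- V_{i+j} = Σ_{d=0}^{k} (-1)^d a_{i+j}^{d+1} V_{i+j-d-1} (where a^{k+1} = 1) truncated at d = j: the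
-- terms with d > j vanish, either because V_{i-k-1} = … = V_{i-2} = 0 or because a^{d+1} = 0 for
-- d > k. As V_{i-1} = 1 = D_0, strong induction on j gives V_{i+j} = D_{j+1}.
module Submission where

open import Defs
open import Algebra.Bundles using (CommutativeRing)
open import Data.Nat as ℕ using (ℕ; zero; suc; _≤_; _<_; _∸_; z≤n; s≤s; _<ᵇ_; _≤ᵇ_; _≡ᵇ_)
open import Data.Integer as ℤ using (ℤ; +_)
import Data.Nat.Properties as ℕₚ
open import Data.Nat.Induction using (<-rec)
import Data.Integer.Properties as ℤₚ
open import Data.Integer.Tactic.RingSolver using (solve-∀)
open import Data.Fin using (Fin; zero; suc; toℕ; punchIn)
open import Data.Bool using (true; false; T; if_then_else_)
open import Data.Empty using (⊥-elim)
open import Data.Product using (_,_)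
open import Data.Sum using (inj₁; inj₂)
open import Relation.Nullary using (¬_; yes; no)
open import Relation.Binary.PropositionalEquality as ≡ using (_≡_)

if-true : ∀ {a} {A : Set a} {b} {x y : A} → T b → (if b then x else y) ≡ x
if-true {b = true} _ = ≡.refl

if-false : ∀ {a} {A : Set a} {b} {x y : A} → ¬ T b → (if b then x else y) ≡ y
if-false {b = false} _ = ≡.refl
if-false {b = true} ¬t = ⊥-elim (¬t _)

<ᵇ-suc : ∀ m n → (m <ᵇ suc n) ≡ (m ≤ᵇ n)
<ᵇ-suc zero n = ≡.refl
<ᵇ-suc (suc m) n = ≡.refl

[i+j]-[j+l]≡i-l : ∀ i j l → (i ℤ.+ + j) ℤ.- + (j ℕ.+ l) ≡ i ℤ.- + l
[i+j]-[j+l]≡i-l i j l =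
  ≡.trans (≡.cong (λ x → (i ℤ.+ + j) ℤ.- x) (ℤₚ.pos-+ j l)) (cancel i (+ j) (+ l))
  where
  cancel : ∀ (x y z : ℤ) → (x ℤ.+ y) ℤ.- (y ℤ.+ z) ≡ x ℤ.- z
  cancel = solve-∀

[i+[1+c+d]]-[1+d]≡i+c : ∀ i c d → (i ℤ.+ + (suc c ℕ.+ d)) ℤ.- + suc d ≡ i ℤ.+ + c
[i+[1+c+d]]-[1+d]≡i+c i c d =
  ≡.trans (≡.cong₂ (λ x y → (i ℤ.+ x) ℤ.- y) (ℤₚ.pos-+ (suc c) d) (ℤₚ.pos-+ 1 d))
          (cancel i (+ c) (+ d))
  where
  cancel : ∀ (x y z : ℤ) → (x ℤ.+ ((+ 1 ℤ.+ y) ℤ.+ z)) ℤ.- (+ 1 ℤ.+ z) ≡ x ℤ.+ y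
  cancel = solve-∀

module _ {ℓ₁ ℓ₂} (R : CommutativeRing ℓ₁ ℓ₂) where
  open WithRing R
  open CommutativeRing R hiding (Carrier; _≈_; zero)
  open import Relation.Binary.Reasoning.Setoid setoid
  open import Algebra.Properties.Ring ring using (-1*x≈-x; x[y-z]≈xy-xz; -‿distribˡ-*)
  open import Algebra.Properties.AbelianGroup +-abelianGroup using (⁻¹-∙-comm)
  open import Algebra.Properties.Group +-group using (ε⁻¹≈ε)
  open import Algebra.Properties.CommutativeSemigroup +-commutativeSemigroup using (interchange)
  open import Algebra.Properties.CommutativeSemigroup *-commutativeSemigroup using (x∙yz≈y∙xz)

  [xa-b]+[xa′-b′]≈x[a+a′]-[b+b′] : ∀ x a b a′ b′ →
    (x * a - b) + (x * a′ - b′) ≈ x * (a + a′) - (b + b′)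
  [xa-b]+[xa′-b′]≈x[a+a′]-[b+b′] x a b a′ b′ = begin
    (x * a - b) + (x * a′ - b′)   ≈⟨ interchange _ _ _ _ ⟩
    (x * a + x * a′) + (- b - b′) ≈⟨ +-cong (sym (distribˡ x a a′)) (⁻¹-∙-comm b b′) ⟩
    x * (a + a′) - (b + b′)       ∎

  s[g[xp-q]]≈x[s[gp]]-s[gq] : ∀ s g x p q → s * (g * (x * p - q)) ≈ x * (s * (g * p)) - s * (g * q)
  s[g[xp-q]]≈x[s[gp]]-s[gq] s g x p q = begin
    s * (g * (x * p - q))           ≈⟨ *-congˡ (x[y-z]≈xy-xz g (x * p) q) ⟩
    s * (g * (x * p) - g * q)       ≈⟨ x[y-z]≈xy-xz s _ _ ⟩
    s * (g * (x * p)) - s * (g * q) ≈⟨ +-congʳ (trans (*-congˡ (x∙yz≈y∙xz g x p)) (x∙yz≈y∙xz s x _)) ⟩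
    x * (s * (g * p)) - s * (g * q) ∎

  x-[su+y]≈[-s]u+[x-y] : ∀ s u x y → x - (s * u + y) ≈ (- s) * u + (x - y)
  x-[su+y]≈[-s]u+[x-y] s u x y = begin
    x - (s * u + y)       ≈⟨ +-congˡ (sym (⁻¹-∙-comm _ _)) ⟩
    x + (- (s * u) - y)   ≈⟨ sym (+-assoc _ _ _) ⟩
    (x - s * u) - y       ≈⟨ +-congʳ (+-comm _ _) ⟩
    (- (s * u) + x) - y   ≈⟨ +-assoc _ _ _ ⟩
    - (s * u) + (x - y)   ≈⟨ +-congʳ (-‿distribˡ-* s u) ⟩
    (- s) * u + (x - y)   ∎

  finSum-cong : ∀ m {f g : Fin m → Carrier} → (∀ t → f t ≈ g t) → finSum m f ≈ finSum m g
  finSum-cong zero f≈g = refl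
  finSum-cong (suc m) f≈g = +-cong (f≈g zero) (finSum-cong m (λ t → f≈g (suc t)))

  finSum-zero : ∀ m {f : Fin m → Carrier} → (∀ t → f t ≈ 0#) → finSum m f ≈ 0#
  finSum-zero zero f≈0 = refl
  finSum-zero (suc m) f≈0 =
    trans (+-cong (f≈0 zero) (finSum-zero m (λ t → f≈0 (suc t)))) (+-identityʳ 0#)

  det-cong : ∀ m {M N : Fin m → Fin m → Carrier} → (∀ r c → M r c ≈ N r c) → det m M ≈ det m N
  det-cong zero M≈N = refl
  det-cong (suc m) M≈N = finSum-cong (suc m) (λ col → *-congˡ {sign (toℕ col)} (*-cong (M≈N zero col)
    (det-cong m (λ r c′ → M≈N (suc r) (punchIn col c′)))))

  sumBelow : ℕ → (ℕ → Carrier) → Carrier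
  sumBelow zero f = 0#
  sumBelow (suc n) f = f 0 + sumBelow n (λ d → f (suc d))

  finSum≡sumBelow : ∀ m f → finSum m (λ t → f (toℕ t)) ≡ sumBelow m f
  finSum≡sumBelow zero f = ≡.refl
  finSum≡sumBelow (suc m) f = ≡.cong (λ s → f 0 + s) (finSum≡sumBelow m (λ d → f (suc d)))

  sumBelow-cong : ∀ n {f g} → (∀ {d} → d < n → f d ≈ g d) → sumBelow n f ≈ sumBelow n g
  sumBelow-cong zero f≈g = refl
  sumBelow-cong (suc n) f≈g = +-cong (f≈g (s≤s z≤n)) (sumBelow-cong n (λ d<n → f≈g (s≤s d<n)))

  sumBelow-suc : ∀ n f → sumBelow (suc n) f ≈ sumBelow n f + f n
  sumBelow-suc zero f = trans (+-identityʳ _) (sym (+-identityˡ _))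
  sumBelow-suc (suc n) f = trans (+-congˡ (sumBelow-suc n (λ d → f (suc d)))) (sym (+-assoc _ _ _))

  sumBelow-zero : ∀ n f → (∀ d → f d ≈ 0#) → sumBelow n f ≈ 0#
  sumBelow-zero zero f f≈0 = refl
  sumBelow-zero (suc n) f f≈0 =
    trans (+-cong (f≈0 0) (sumBelow-zero n (λ d → f (suc d)) (λ d → f≈0 (suc d)))) (+-identityʳ _)

  sumBelow-+-vanishing : ∀ p o f → (∀ {d} → p ≤ d → f d ≈ 0#) → sumBelow (p ℕ.+ o) f ≈ sumBelow p f
  sumBelow-+-vanishing zero o f f≈0 = sumBelow-zero o f (λ d → f≈0 z≤n)
  sumBelow-+-vanishing (suc p) o f f≈0 =
    +-congˡ (sumBelow-+-vanishing p o (λ d → f (suc d)) (λ p≤d → f≈0 (s≤s p≤d)))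

  sumBelow-vanishing : ∀ {p q} f → (∀ {d} → p ≤ d → f d ≈ 0#) → p ≤ q → sumBelow q f ≈ sumBelow p f
  sumBelow-vanishing {p} f f≈0 p≤q with ℕₚ.m≤n⇒∃[o]m+o≡n p≤q
  ... | o , ≡.refl = sumBelow-+-vanishing p o f f≈0

  antidiagonalSum : ℕ → (ℕ → ℕ → Carrier) → Carrier
  antidiagonalSum zero f = f 0 0
  antidiagonalSum (suc m) f = f 0 (suc m) + antidiagonalSum m (λ c → f (suc c))

  antidiagonalSum-cong : ∀ m {f g} → (∀ c d → c ℕ.+ d ≡ m → f c d ≈ g c d) →
    antidiagonalSum m f ≈ antidiagonalSum m g
  antidiagonalSum-cong zero f≈g = f≈g 0 0 ≡.refl
  antidiagonalSum-cong (suc m) f≈g =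
    +-cong (f≈g 0 (suc m) ≡.refl) (antidiagonalSum-cong m (λ c d e → f≈g (suc c) d (≡.cong suc e)))

  antidiagonalSum-linear : ∀ m x f g →
    antidiagonalSum m (λ c d → x * f c d - g c d) ≈ x * antidiagonalSum m f - antidiagonalSum m g
  antidiagonalSum-linear zero x f g = refl
  antidiagonalSum-linear (suc m) x f g =
    trans (+-congˡ (antidiagonalSum-linear m x (λ c → f (suc c)) (λ c → g (suc c))))
          ([xa-b]+[xa′-b′]≈x[a+a′]-[b+b′] _ _ _ _ _)

  antidiagonalSum-split : ∀ m f g → (∀ d → g 0 d ≈ 0#) → (∀ c d → g (suc c) d ≈ f (suc c) d) →
    antidiagonalSum m f ≈ f 0 m + antidiagonalSum m g
  antidiagonalSum-split zero f g g0≈0 _ = sym (trans (+-congˡ (g0≈0 0)) (+-identityʳ _))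
  antidiagonalSum-split (suc m) f g g0≈0 g≈f = +-congˡ (sym (trans (+-congʳ (g0≈0 (suc m)))
    (trans (+-identityˡ _) (antidiagonalSum-cong m (λ c d _ → g≈f c d)))))

  antidiagonalSum-const : ∀ m f → antidiagonalSum m (λ _ d → f d) ≈ sumBelow (suc m) f
  antidiagonalSum-const zero f = sym (+-identityʳ _)
  antidiagonalSum-const (suc m) f =
    trans (+-congˡ (antidiagonalSum-const m f)) (trans (+-comm _ _) (sym (sumBelow-suc (suc m) f)))

  Mat : Set ℓ₁
  Mat = ℕ → ℕ → Carrier

  hessenberg : Mat → Mat
  hessenberg h zero zero = h 0 0
  hessenberg h zero (suc zero) = 1#
  hessenberg h zero (suc (suc c)) = 0#
  hessenberg h (suc r) zero = h (suc r) 0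
  hessenberg h (suc r) (suc c) = hessenberg (λ r c → h (suc r) (suc c)) r c

  hessenberg≡if : ∀ h r c →
    hessenberg h r c ≡ (if c ≤ᵇ r then h r c else (if c ≡ᵇ suc r then 1# else 0#))
  hessenberg≡if h zero zero = ≡.refl
  hessenberg≡if h zero (suc zero) = ≡.refl
  hessenberg≡if h zero (suc (suc c)) = ≡.refl
  hessenberg≡if h (suc r) zero = ≡.refl
  hessenberg≡if h (suc r) (suc c) rewrite <ᵇ-suc c r = hessenberg≡if (λ r c → h (suc r) (suc c)) r c

  hessenberg-cong : ∀ {g h} → (∀ r c → g r c ≈ h r c) → ∀ r c → hessenberg g r c ≈ hessenberg h r c
  hessenberg-cong g≈h zero zero = g≈h 0 0
  hessenberg-cong g≈h zero (suc zero) = refl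
  hessenberg-cong g≈h zero (suc (suc c)) = refl
  hessenberg-cong g≈h (suc r) zero = g≈h (suc r) 0
  hessenberg-cong g≈h (suc r) (suc c) = hessenberg-cong (λ r c → g≈h (suc r) (suc c)) r c

  hessenberg-col₀ : ∀ h r → hessenberg h r 0 ≡ h r 0
  hessenberg-col₀ h zero = ≡.refl
  hessenberg-col₀ h (suc r) = ≡.refl

  hessenberg-cong-suc : ∀ {g h} → (∀ r c → g r (suc c) ≈ h r (suc c)) →
    ∀ r c → hessenberg g r (suc c) ≈ hessenberg h r (suc c)
  hessenberg-cong-suc g≈h zero zero = refl
  hessenberg-cong-suc g≈h zero (suc c) = refl
  hessenberg-cong-suc g≈h (suc r) c = hessenberg-cong (λ r c → g≈h (suc r) c) r c

  -- Coefficient arrays of the minors of hessenberg h at the entries (0, 0) and (0, 1).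
  minor₀₀ minor₀₁ : Mat → Mat
  minor₀₀ h r c = h (suc r) (suc c)
  minor₀₁ h r zero = h (suc r) zero
  minor₀₁ h r (suc c) = h (suc r) (suc (suc c))

  hessenberg-minor₀₁ : ∀ {m} h (r c : Fin (suc m)) →
    hessenberg h (suc (toℕ r)) (toℕ (punchIn (suc zero) c)) ≈ hessenberg (minor₀₁ h) (toℕ r) (toℕ c)
  hessenberg-minor₀₁ h r zero = reflexive (≡.sym (hessenberg-col₀ (minor₀₁ h) (toℕ r)))
  hessenberg-minor₀₁ h r (suc c) = hessenberg-cong-suc (λ _ _ → refl) (toℕ r) (toℕ c)

  hessenbergDet : ℕ → Mat → Carrier
  hessenbergDet m h = det m (λ r c → hessenberg h (toℕ r) (toℕ c))

  -- For m = 0 the matrix is 1×1 and has no entry (0, 1), hence the value 0.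
  minor₀₁Det : Mat → ℕ → Carrier
  minor₀₁Det h zero = 0#
  minor₀₁Det h (suc m) = hessenbergDet (suc m) (minor₀₁ h)

  hessenbergDet-firstRow : ∀ h m →
    hessenbergDet (suc m) h ≈ h 0 0 * hessenbergDet m (minor₀₀ h) - minor₀₁Det h m
  hessenbergDet-firstRow h zero = +-cong (*-identityˡ _) (sym ε⁻¹≈ε)
  hessenbergDet-firstRow h (suc m) = +-cong (*-identityˡ _) (begin
      (- 1#) * (1# * det (suc m) (minor (suc zero)))
        + finSum m (λ col → sign (toℕ (suc (suc col))) * (0# * det (suc m) (minor (suc (suc col)))))
    ≈⟨ +-cong (-1*x≈-x _) (finSum-zero m (λ _ → trans (*-congˡ (zeroˡ _)) (zeroʳ _))) ⟩
      - (1# * det (suc m) (minor (suc zero))) + 0#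
    ≈⟨ +-identityʳ _ ⟩
      - (1# * det (suc m) (minor (suc zero)))
    ≈⟨ -‿cong (trans (*-identityˡ _) (det-cong (suc m) (hessenberg-minor₀₁ h))) ⟩
      - hessenbergDet (suc m) (minor₀₁ h) ∎)
    where
    minor : Fin (suc (suc m)) → Fin (suc m) → Fin (suc m) → Carrier
    minor col r c = hessenberg h (suc (toℕ r)) (toℕ (punchIn col c))

  hessenbergDet-lastRow : ∀ m h →
    hessenbergDet (suc m) h ≈ antidiagonalSum m (λ c d → sign d * (h m c * hessenbergDet c h))
  hessenbergDet-lastRow zero h = +-identityʳ _
  hessenbergDet-lastRow (suc m) h = begin
      hessenbergDet (suc (suc m)) h
    ≈⟨ hessenbergDet-firstRow h (suc m) ⟩
      h 0 0 * hessenbergDet (suc m) (minor₀₀ h) - hessenbergDet (suc m) (minor₀₁ h)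
    ≈⟨ +-cong (*-congˡ (hessenbergDet-lastRow m (minor₀₀ h)))
              (-‿cong (hessenbergDet-lastRow m (minor₀₁ h))) ⟩
      h 0 0 * antidiagonalSum m A - antidiagonalSum m A′
    ≈⟨ +-congˡ (-‿cong (antidiagonalSum-split m A′ B B₀≈0 (λ _ _ → refl))) ⟩
      h 0 0 * antidiagonalSum m A - (sign m * (h (suc m) 0 * 1#) + antidiagonalSum m B)
    ≈⟨ x-[su+y]≈[-s]u+[x-y] _ _ _ _ ⟩
      sign (suc m) * (h (suc m) 0 * 1#) + (h 0 0 * antidiagonalSum m A - antidiagonalSum m B)
    ≈⟨ +-congˡ (sym (antidiagonalSum-linear m (h 0 0) A B)) ⟩
      sign (suc m) * (h (suc m) 0 * 1#) + antidiagonalSum m (λ c d → h 0 0 * A c d - B c d)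
    ≈⟨ +-congˡ (antidiagonalSum-cong m (λ c d _ → sym (trans
         (*-congˡ (*-congˡ (hessenbergDet-firstRow h c))) (s[g[xp-q]]≈x[s[gp]]-s[gq] _ _ _ _ _)))) ⟩
      antidiagonalSum (suc m) (λ c d → sign d * (h (suc m) c * hessenbergDet c h)) ∎
    where
    A A′ B : ℕ → ℕ → Carrier
    A c d = sign d * (h (suc m) (suc c) * hessenbergDet c (minor₀₀ h))
    A′ c d = sign d * (minor₀₁ h m c * hessenbergDet c (minor₀₁ h))
    B c d = sign d * (h (suc m) (suc c) * minor₀₁Det h c)
    B₀≈0 : ∀ d → B 0 d ≈ 0#
    B₀≈0 d = trans (*-congˡ (zeroʳ _)) (zeroʳ _)

  ext-≤ : ∀ {k l} a m → l ≤ k → ext k a m l ≡ a m l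
  ext-≤ a m l≤k = if-true (ℕₚ.≤⇒≤ᵇ l≤k)

  ext-suc : ∀ k a m → ext k a m (suc k) ≡ 1#
  ext-suc k a m = ≡.trans (if-false (λ t → ℕₚ.<-irrefl ≡.refl (ℕₚ.≤ᵇ⇒≤ (suc k) k t)))
                          (if-true (ℕₚ.≡⇒≡ᵇ (suc k) (suc k) ≡.refl))

  ext-> : ∀ {k l} a m → suc k < l → ext k a m l ≡ 0#
  ext-> {k} {l} a m 1+k<l = ≡.trans
    (if-false (λ t → ℕₚ.<⇒≱ (ℕₚ.<-trans (ℕₚ.n<1+n k) 1+k<l) (ℕₚ.≤ᵇ⇒≤ l k t)))
    (if-false (λ t → ℕₚ.<⇒≢ 1+k<l (≡.sym (ℕₚ.≡ᵇ⇒≡ l (suc k) t))))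

  module FriezeRow (k : ℕ) (a : Coeffs) (i : ℤ) {V : ℤ → Carrier} (isSolution : IsSolution k a V)
    (initialZeros : ∀ l → 2 ≤ l → l ≤ suc k → V (i ℤ.- + l) ≈ 0#) (initialOne : V (i ℤ.- + 1) ≈ 1#)
    where

    coefficients : Mat
    coefficients r c = ext k a (i ℤ.+ + r) (suc (r ∸ c))

    term : ℕ → ℕ → Carrier
    term j d = sign d * (ext k a (i ℤ.+ + j) (suc d) * V ((i ℤ.+ + j) ℤ.- + suc d))

    recurrence : ∀ j → V (i ℤ.+ + j) ≈ sumBelow (suc k) (term j)
    recurrence j = begin
        V (i ℤ.+ + j)
      ≈⟨ isSolution (i ℤ.+ + j) ⟩
        finSum k (λ t → summand (toℕ t)) + last
      ≡⟨ ≡.cong (λ s → s + last) (finSum≡sumBelow k summand) ⟩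
        sumBelow k summand + last
      ≈⟨ +-cong (sumBelow-cong k (λ d<k → *-congˡ (*-congʳ (reflexive (≡.sym (ext-≤ a _ d<k))))))
                (*-congˡ (trans (sym (*-identityˡ _)) (*-congʳ (reflexive (≡.sym (ext-suc k a _)))))) ⟩
        sumBelow k (term j) + term j k
      ≈⟨ sym (sumBelow-suc k (term j)) ⟩
        sumBelow (suc k) (term j) ∎
      where
      summand : ℕ → Carrier
      summand d = sign d * (a (i ℤ.+ + j) (suc d) * V ((i ℤ.+ + j) ℤ.- + suc d))
      last : Carrier
      last = sign k * V ((i ℤ.+ + j) ℤ.- + suc k)

    term-vanishes-beyond-k : ∀ j {d} → k < d → term j d ≈ 0#
    term-vanishes-beyond-k j k<d =
      trans (*-congˡ (trans (*-congʳ (reflexive (ext-> a _ (s≤s k<d)))) (zeroˡ _))) (zeroʳ _)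

    term-vanishes-initial : ∀ j {d} → j < d → d ≤ k → term j d ≈ 0#
    term-vanishes-initial j j<d d≤k with ℕₚ.m≤n⇒∃[o]m+o≡n j<d
    ... | o , ≡.refl = trans (*-congˡ (trans (*-congˡ V≈0) (zeroʳ _))) (zeroʳ _)
      where
      index : (i ℤ.+ + j) ℤ.- + suc (suc j ℕ.+ o) ≡ i ℤ.- + suc (suc o)
      index = ≡.trans
        (≡.cong (λ x → (i ℤ.+ + j) ℤ.- + x)
                (≡.sym (≡.trans (ℕₚ.+-suc j (suc o)) (≡.cong suc (ℕₚ.+-suc j o)))))
        ([i+j]-[j+l]≡i-l i j (suc (suc o)))
      V≈0 : V ((i ℤ.+ + j) ℤ.- + suc (suc j ℕ.+ o)) ≈ 0#
      V≈0 = trans (reflexive (≡.cong V index))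
        (initialZeros (suc (suc o)) (s≤s (s≤s z≤n)) (s≤s (ℕₚ.≤-trans (s≤s (ℕₚ.m≤n+m o j)) d≤k)))

    term-vanishes : ∀ j {d} → j < d → term j d ≈ 0#
    term-vanishes j {d} j<d with d ℕ.≤? k
    ... | yes d≤k = term-vanishes-initial j j<d d≤k
    ... | no d≰k = term-vanishes-beyond-k j (ℕₚ.≰⇒> d≰k)

    recurrence-truncated : ∀ j → V (i ℤ.+ + j) ≈ sumBelow (suc j) (term j)
    recurrence-truncated j with ℕₚ.≤-total j k
    ... | inj₁ j≤k = trans (recurrence j) (sumBelow-vanishing (term j) (term-vanishes j) (s≤s j≤k))
    ... | inj₂ k≤j =
      trans (recurrence j) (sym (sumBelow-vanishing (term j) (term-vanishes-beyond-k j) (s≤s k≤j)))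

    RowIdentity : ℕ → Set ℓ₂
    RowIdentity j = V (i ℤ.+ + j) ≈ hessenbergDet (suc j) coefficients

    earlierEntry≈hessenbergDet : ∀ c d → (∀ {c′} → c′ < c ℕ.+ d → RowIdentity c′) →
      V ((i ℤ.+ + (c ℕ.+ d)) ℤ.- + suc d) ≈ hessenbergDet c coefficients
    earlierEntry≈hessenbergDet zero d _ = trans (reflexive (≡.cong V index)) initialOne
      where
      index : (i ℤ.+ + d) ℤ.- + suc d ≡ i ℤ.- + 1
      index = ≡.trans (≡.cong (λ x → (i ℤ.+ + d) ℤ.- + x) (ℕₚ.+-comm 1 d)) ([i+j]-[j+l]≡i-l i d 1)
    earlierEntry≈hessenbergDet (suc c) d rows =
      trans (reflexive (≡.cong V ([i+[1+c+d]]-[1+d]≡i+c i c d))) (rows (s≤s (ℕₚ.m≤m+n c d)))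

    term≈lastRowTerm : ∀ {j} → (∀ {c} → c < j → RowIdentity c) →
      ∀ c d → c ℕ.+ d ≡ j → term j d ≈ sign d * (coefficients j c * hessenbergDet c coefficients)
    term≈lastRowTerm rows c d ≡.refl = *-congˡ (*-cong
      (reflexive (≡.cong (λ x → ext k a (i ℤ.+ + (c ℕ.+ d)) (suc x)) (≡.sym (ℕₚ.m+n∸m≡n c d))))
      (earlierEntry≈hessenbergDet c d rows))

    rowIdentity : ∀ j → RowIdentity j
    rowIdentity = <-rec RowIdentity λ j rows → begin
        V (i ℤ.+ + j)
      ≈⟨ recurrence-truncated j ⟩
        sumBelow (suc j) (term j)
      ≈⟨ sym (antidiagonalSum-const j (term j)) ⟩
        antidiagonalSum j (λ _ d → term j d)
      ≈⟨ antidiagonalSum-cong j (term≈lastRowTerm rows) ⟩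
        antidiagonalSum j (λ c d → sign d * (coefficients j c * hessenbergDet c coefficients))
      ≈⟨ sym (hessenbergDet-lastRow j coefficients) ⟩
        hessenbergDet (suc j) coefficients ∎

    row≈det : ∀ j → V (i ℤ.+ + j) ≈ det (suc j) (friezeMatrix k a i j)
    row≈det j = trans (rowIdentity j)
      (det-cong (suc j) (λ r c → reflexive (hessenberg≡if coefficients (toℕ r) (toℕ c))))

-- The identity holds for every j ≥ 0.
proposition5p1 : ∀ {c ℓ} (R : CommutativeRing c ℓ) →
    let open WithRing R in
    (k n : ℕ) → 1 ≤ k → suc (suc k) ≤ n →
    (a : Coeffs) → InE k n a →
    (i : ℤ) (V : ℤ → Carrier) → IsFriezeRow k a i V →
    (j : ℕ) → j < n ∸ k ∸ 2 →
    V (i ℤ.+ + j) ≈ det (suc j) (friezeMatrix k a i j)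
proposition5p1 R k _ _ _ a _ i V (isSolution , initialZeros , initialOne) j _ =
  FriezeRow.row≈det R k a i isSolution initialZeros initialOne j
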